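{- For all graphs $G,H$, if $H$ is a minor of $G$, then $\operatorname{rtd}_2(H)\le\operatorname{rtd}_2(G)$.
   Context: Rooted $2$-treedepth: $\operatorname{rtd}_2(G)=0$ if $G$ is the null graph; $=1$ if $G$ has one vertex; otherwise $\operatorname{rtd}_2(G)$ is the minimum of $\max\{\operatorname{rtd}_2(A),\operatorname{rtd}_2(B-V(A))+|V(A)\cap V(B)|\}$ over all pairs $(A,B)$ of subgraphs of $G$ with $A\cup B=G$, $E(A\cap B)=\emptyset$, $|V(A)\cap V(B)|\le 1$, $V(A)\ne\emptyset$ and $V(B)\setminus V(A)\ne\emptyset$. -}

module Defs where

open import Level using (0ℓ)
open import Data.Nat using (ℕ; _+_; _≤_)
open import Data.Fin using (Fin)
open import Data.Fin.Subset using (Subset; _∈_; _∉_; _⊆_; _∩_; _∪_; _─_; ∣_∣; Nonempty; ⊤)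
open import Data.Maybe using (Maybe; just)
open import Data.Product using (Σ; ∃; ∃-syntax; _×_; _,_)
open import Data.Sum using (_⊎_)
open import Relation.Nullary using (¬_)
open import Relation.Binary.PropositionalEquality using (_≡_)
open import Function.Bundles using (_⇔_)
import Data.Fin.Subset.Properties as P
open import Data.Vec using (_∷_)
open import Data.Vec.Base using (_[_]=_; here; there)
open import Data.Empty using (⊥-elim)
open import Data.Fin.Subset using (Side; inside; outside)

record Graph : Set₁ where
  field
    n     : ℕ
    Adj   : Fin n → Fin n → Set
    sym   : ∀ {u v} → Adj u v → Adj v u
    irref : ∀ {u} → ¬ Adj u u
open Graph public

record Sub (G : Graph) : Set₁ where
  field
    V     : Subset (n G)
    E     : Fin (n G) → Fin (n G) → Set
    E⊆    : ∀ {u v} → E u v → Adj G u v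
    Eends : ∀ {u v} → E u v → u ∈ V × v ∈ V
    Esym  : ∀ {u v} → E u v → E v u
open Sub public

full : (G : Graph) → Sub G
full G = record
  { V = ⊤ ; E = Adj G ; E⊆ = λ e → e
  ; Eends = λ _ → P.∈⊤ , P.∈⊤
  ; Esym = sym G }

∈─⁺ : ∀ {m} {x : Fin m} (p q : Subset m) → x ∈ p → x ∉ q → x ∈ p ─ q
∈─⁺ (inside ∷ p) (outside ∷ q) here x∉ = here
∈─⁺ (inside ∷ p) (inside ∷ q) here x∉ = ⊥-elim (x∉ here)
∈─⁺ (_ ∷ p) (outside ∷ q) (there x∈) x∉ = there (∈─⁺ p q x∈ (λ z → x∉ (there z)))
∈─⁺ (_ ∷ p) (inside ∷ q) (there x∈) x∉ = there (∈─⁺ p q x∈ (λ z → x∉ (there z)))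

_∖V_ : {G : Graph} → Sub G → Subset (n G) → Sub G
_∖V_ {G} B X = record
  { V = V B ─ X
  ; E = λ u v → E B u v × u ∉ X × v ∉ X
  ; E⊆ = λ { (e , _) → E⊆ B e }
  ; Eends = λ { {u} {v} (e , u∉ , v∉) →
      let (u∈ , v∈) = Eends B e in
      ∈─⁺ (V B) X u∈ u∉ , ∈─⁺ (V B) X v∈ v∉ }
  ; Esym = λ { (e , u∉ , v∉) → Esym B e , v∉ , u∉ } }

record IsUnion {G : Graph} (A B S : Sub G) : Set where
  field
    vertices : ∀ v → v ∈ V S ⇔ (v ∈ V A ⊎ v ∈ V B)
    edges    : ∀ u v → E S u v ⇔ (E A u v ⊎ E B u v)

record Separation {G : Graph} (S A B : Sub G) : Set where
  field
    union     : IsUnion A B S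
    edge-disj : ∀ u v → ¬ (E A u v × E B u v)
    small     : ∣ V A ∩ V B ∣ ≤ 1
    A-nonempty  : Nonempty (V A)
    B∖A-nonempty : Nonempty (V B ─ V A)

-- Rtd≤ S k  means  rtd₂(S) ≤ k.  This is the literal unfolding of the
-- recursive min/max definition of rtd₂:
--   rtd₂ = 0 for the null graph, 1 for a one-vertex graph, and otherwise
--   min over admissible (A , B) of max{rtd₂(A), rtd₂(B - V(A)) + |V(A) ∩ V(B)|}.

data Rtd≤ {G : Graph} : Sub G → ℕ → Set₁ where
  null : ∀ {S k} → ∣ V S ∣ ≡ 0 → Rtd≤ S k
  one  : ∀ {S k} → ∣ V S ∣ ≡ 1 → 1 ≤ k → Rtd≤ S k
  sep  : ∀ {S k} → 2 ≤ ∣ V S ∣ →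
         (A B : Sub G) → Separation S A B →
         Rtd≤ A k →
         (j : ℕ) → Rtd≤ (B ∖V V A) j → j + ∣ V A ∩ V B ∣ ≤ k →
         Rtd≤ S k

IsRtd₂ : {G : Graph} → Sub G → ℕ → Set₁
IsRtd₂ S k = Rtd≤ S k × (∀ j → Rtd≤ S j → k ≤ j)

rtd₂≡ : Graph → ℕ → Set₁
rtd₂≡ G k = IsRtd₂ (full G) k

data PathIn (G : Graph) (P : Fin (n G) → Set) : Fin (n G) → Fin (n G) → Set where
  here : ∀ {u} → PathIn G P u u
  step : ∀ {u w v} → Adj G u w → P w → PathIn G P w v → PathIn G P u v

-- H is a minor of G: a map φ sending each vertex of G to at most one
-- vertex of H (branch sets φ⁻¹(h) are pairwise disjoint) such that every
-- branch set is nonempty and connected, and adjacent vertices of H have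
-- branch sets joined by an edge of G.
record Minor (H G : Graph) : Set where
  field
    φ         : Fin (n G) → Maybe (Fin (n H))
    nonempty  : ∀ h → ∃[ g ] φ g ≡ just h
    connected : ∀ h g g' → φ g ≡ just h → φ g' ≡ just h →
                PathIn G (λ x → φ x ≡ just h) g g'
    edges     : ∀ h h' → Adj H h h' →
                ∃[ g ] ∃[ g' ] (φ g ≡ just h × φ g' ≡ just h' × Adj G g g')

-- A minor model of T in S (disjoint connected branch sets, adjacent vertices having adjacent
-- branch sets) transports any witness of rtd₂(S) ≤ k to one of rtd₂(T) ≤ k, by induction on
-- the witness.  A separation (A , B) of S pulls back to T: let A′ be the vertices whose branch
-- set meets A and B′ those whose branch set meets B.  A connected branch set meeting both A
-- and B passes through the separator vertex, so at most one vertex of T lies in A′ ∩ B′ and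
-- only if |V(A) ∩ V(B)| = 1, and the branch sets restricted to A, resp. to B − V(A), are minor
-- models of A′ in A, resp. of B′ − V(A′) in B − V(A).  When A′ or B′ − V(A′) is empty, T itself
-- is a minor of B − V(A), resp. of A.

module Submission where

open import Defs hiding (sym)
open import Data.Nat using (ℕ; zero; suc; _≤_; _+_; z≤n; s≤s; _≤?_)
open import Data.Nat.Properties using (≤-trans; ≤-reflexive; m≤m+n; +-monoʳ-≤; n≤0⇒n≡0; ≰⇒>)
open import Data.Fin using (Fin; zero; suc)
open import Data.Fin.Properties using (any?; suc-injective) renaming (_≟_ to _≟ᶠ_)
open import Data.Fin.Subset using (Subset; _∈_; _∉_; _⊆_; _∩_; _─_; ∣_∣; Nonempty; Empty; inside; outside)
open import Data.Fin.Subset.Properties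
  using (_∈?_; x∈p∩q⁺; x∈p∩q⁻; nonempty?; Empty-unique; ∣⊥∣≡0; ∈⊤; p─q⊆p; x∈p∧x∉q⇒x∈p─q)
open import Data.Maybe using (just)
open import Data.Maybe.Properties using (just-injective; ≡-dec)
open import Data.Vec using (_∷_; []; tabulate)
open import Data.Vec.Base using (here; there)
open import Data.Vec.Properties using (lookup∘tabulate; lookup⇒[]=; []=⇒lookup)
open import Data.Product using (∃-syntax; _×_; _,_; proj₁; proj₂)
open import Data.Sum using (_⊎_; inj₁; inj₂; [_,_])
open import Data.Empty using (⊥-elim)
open import Function using (_∘_)
open import Function.Bundles using (mk⇔; Equivalence)
open import Relation.Nullary using (¬_; Dec; yes; no; does)
open import Relation.Nullary.Decidable using (_×-dec_; ¬?; dec-true)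
open import Relation.Binary.PropositionalEquality using (_≡_; refl; sym; trans; subst; cong)

Subsingleton : ∀ {m} → Subset m → Set
Subsingleton p = ∀ {x y} → x ∈ p → y ∈ p → x ≡ y

∣p∣≡0⇒Empty : ∀ {m} (p : Subset m) → ∣ p ∣ ≡ 0 → Empty p
∣p∣≡0⇒Empty (inside ∷ p)  ()  _
∣p∣≡0⇒Empty (outside ∷ p) eq (suc x , there x∈p) = ∣p∣≡0⇒Empty p eq (x , x∈p)

Empty⇒∣p∣≡0 : ∀ {m} {p : Subset m} → Empty p → ∣ p ∣ ≡ 0
Empty⇒∣p∣≡0 {m} p-empty rewrite Empty-unique p-empty = ∣⊥∣≡0 m

∣p∣≤1⇒Subsingleton : ∀ {m} (p : Subset m) → ∣ p ∣ ≤ 1 → Subsingleton p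
∣p∣≤1⇒Subsingleton (inside ∷ p)  _        here        here        = refl
∣p∣≤1⇒Subsingleton (inside ∷ p)  (s≤s ≤0) here        (there y∈p) = ⊥-elim (∣p∣≡0⇒Empty p (n≤0⇒n≡0 ≤0) (_ , y∈p))
∣p∣≤1⇒Subsingleton (inside ∷ p)  (s≤s ≤0) (there x∈p) _           = ⊥-elim (∣p∣≡0⇒Empty p (n≤0⇒n≡0 ≤0) (_ , x∈p))
∣p∣≤1⇒Subsingleton (outside ∷ p) ≤1       (there x∈p) (there y∈p) =
  cong suc (∣p∣≤1⇒Subsingleton p ≤1 x∈p y∈p)

Subsingleton⇒∣p∣≤1 : ∀ {m} (p : Subset m) → Subsingleton p → ∣ p ∣ ≤ 1
Subsingleton⇒∣p∣≤1 []            _    = z≤n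
Subsingleton⇒∣p∣≤1 (inside ∷ p)  uniq =
  s≤s (≤-reflexive (Empty⇒∣p∣≡0 λ (_ , x∈p) → zero≢suc (uniq here (there x∈p))))
  where
  zero≢suc : ∀ {m} {x : Fin m} → ¬ zero ≡ suc x
  zero≢suc ()
Subsingleton⇒∣p∣≤1 (outside ∷ p) uniq =
  Subsingleton⇒∣p∣≤1 p λ x∈p y∈p → suc-injective (uniq (there x∈p) (there y∈p))

Subsingleton⇒∣p∣≤∣q∣ : ∀ {m m'} (p : Subset m) (q : Subset m') →
                       Subsingleton p → (Nonempty p → Nonempty q) → ∣ p ∣ ≤ ∣ q ∣
Subsingleton⇒∣p∣≤∣q∣ p q uniq inhabits with ∣ q ∣ in eq
... | zero  = ≤-reflexive (Empty⇒∣p∣≡0 (∣p∣≡0⇒Empty q eq ∘ inhabits))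
... | suc _ = ≤-trans (Subsingleton⇒∣p∣≤1 p uniq) (s≤s z≤n)

x∈p─q⇒x∉q : ∀ {m} (p q : Subset m) {x} → x ∈ p ─ q → x ∉ q
x∈p─q⇒x∉q (inside ∷ p) (outside ∷ q) here        ()
x∈p─q⇒x∉q (_ ∷ p)      (inside ∷ q)  (there x∈) (there x∈q) = x∈p─q⇒x∉q p q x∈ x∈q
x∈p─q⇒x∉q (_ ∷ p)      (outside ∷ q) (there x∈) (there x∈q) = x∈p─q⇒x∉q p q x∈ x∈q

select : ∀ {m} {P : Fin m → Set} → (∀ x → Dec (P x)) → Subset m
select P? = tabulate (does ∘ P?)

∈-select⁺ : ∀ {m} {P : Fin m → Set} (P? : ∀ x → Dec (P x)) {x} → P x → x ∈ select P?
∈-select⁺ P? {x} px = lookup⇒[]= x _ (trans (lookup∘tabulate (does ∘ P?) x) (dec-true (P? x) px))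

∈-select⁻ : ∀ {m} {P : Fin m → Set} (P? : ∀ x → Dec (P x)) {x} → x ∈ select P? → P x
∈-select⁻ P? {x} x∈ with P? x | trans (sym (lookup∘tabulate (does ∘ P?) x)) ([]=⇒lookup x∈)
... | yes px | _ = px
... | no _   | ()

Rtd≤-mono : ∀ {G} {S : Sub G} {j k} → Rtd≤ S j → j ≤ k → Rtd≤ S k
Rtd≤-mono (null empty)                 _   = null empty
Rtd≤-mono (one single 1≤j)             j≤k = one single (≤-trans 1≤j j≤k)
Rtd≤-mono (sep two A B sp rA i rB i≤j) j≤k = sep two A B sp (Rtd≤-mono rA j≤k) i rB (≤-trans i≤j j≤k)

Rtd≤-positive : ∀ {G} {S : Sub G} {k} → Rtd≤ S k → Nonempty (V S) → 1 ≤ k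
Rtd≤-positive {S = S} (null empty) S≢∅ = ⊥-elim (∣p∣≡0⇒Empty (V S) empty S≢∅)
Rtd≤-positive (one _ 1≤k)              _   = 1≤k
Rtd≤-positive (sep _ _ _ sp rA _ _ _)  _   = Rtd≤-positive rA (Separation.A-nonempty sp)

Rtd≤-subsingleton : ∀ {G} {S : Sub G} {k} → ∣ V S ∣ ≤ 1 → 1 ≤ k → Rtd≤ S k
Rtd≤-subsingleton {S = S} ≤1 1≤k with ∣ V S ∣ in eq
Rtd≤-subsingleton _        _   | zero     = null eq
Rtd≤-subsingleton _        1≤k | suc zero = one eq 1≤k
Rtd≤-subsingleton (s≤s ()) _   | suc (suc _)

-- As PathIn, the start vertex need not satisfy P.
data Walk {G : Graph} (S : Sub G) (P : Fin (n G) → Set) : Fin (n G) → Fin (n G) → Set where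
  stop : ∀ {u} → Walk S P u u
  step : ∀ {u w v} → E S u w → P w → Walk S P w v → Walk S P u v

PathIn⇒Walk : ∀ {G : Graph} {P : Fin (n G) → Set} {u v} → PathIn G P u v → Walk (full G) P u v
PathIn⇒Walk here            = stop
PathIn⇒Walk (step e pw rest) = step e pw (PathIn⇒Walk rest)

record MinorModel {G H : Graph} (T : Sub H) (S : Sub G) : Set₁ where
  field
    branch    : Fin (n H) → Fin (n G) → Set
    branch?   : ∀ h g → Dec (branch h g)
    branch⊆S  : ∀ {h g} → branch h g → g ∈ V S
    disjoint  : ∀ {h h' g} → branch h g → branch h' g → h ≡ h'
    nonempty  : ∀ {h} → h ∈ V T → ∃[ g ] branch h g
    connected : ∀ {h g g'} → h ∈ V T → branch h g → branch h g' → Walk S (branch h) g g'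
    edge      : ∀ {h h'} → E T h h' → ∃[ g ] ∃[ g' ] (branch h g × branch h' g' × E S g g')

  Meets : Fin (n H) → Subset (n G) → Set
  Meets h X = ∃[ g ] (branch h g × g ∈ X)

  meets? : ∀ h X → Dec (Meets h X)
  meets? h X = any? (λ g → branch? h g ×-dec (g ∈? X))

Minor⇒MinorModel : ∀ {G H} → Minor H G → MinorModel (full H) (full G)
Minor⇒MinorModel {G} {H} minor = record
  { branch    = λ h g → φ g ≡ just h
  ; branch?   = λ h g → ≡-dec _≟ᶠ_ (φ g) (just h)
  ; branch⊆S  = λ _ → ∈⊤
  ; disjoint  = λ φg≡h φg≡h' → just-injective (trans (sym φg≡h) φg≡h')
  ; nonempty  = λ {h} _ → nonempty h
  ; connected = λ {h} {g} {g'} _ φg≡h φg'≡h → PathIn⇒Walk (connected h g g' φg≡h φg'≡h)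
  ; edge      = λ {h} {h'} e → edges h h' e }
  where open Minor minor

record _⊑_ {H : Graph} (T' T : Sub H) : Set where
  field
    V-mono : V T' ⊆ V T
    E-mono : ∀ {h h'} → E T' h h' → E T h h'

MinorModel-restrict : ∀ {G H} {S : Sub G} {T T' : Sub H} → T' ⊑ T → MinorModel T S → MinorModel T' S
MinorModel-restrict T'⊑T M = record
  { branch    = branch
  ; branch?   = branch?
  ; branch⊆S  = branch⊆S
  ; disjoint  = disjoint
  ; nonempty  = nonempty ∘ V-mono
  ; connected = connected ∘ V-mono
  ; edge      = edge ∘ E-mono }
  where open MinorModel M; open _⊑_ T'⊑T

MinorModel-nonempty : ∀ {G H} {S : Sub G} {T : Sub H} → MinorModel T S → Nonempty (V T) → Nonempty (V S)
MinorModel-nonempty M (_ , hT) = let (_ , b) = MinorModel.nonempty M hT in _ , MinorModel.branch⊆S M b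

MinorModel-subsingleton : ∀ {G H} {S : Sub G} {T : Sub H} → MinorModel T S → ∣ V S ∣ ≤ 1 → ∣ V T ∣ ≤ 1
MinorModel-subsingleton {S = S} {T} M ≤1 = Subsingleton⇒∣p∣≤1 (V T) λ hT h'T →
  let (_ , b) = nonempty hT ; (_ , b') = nonempty h'T
  in disjoint b (subst (branch _) (sym (∣p∣≤1⇒Subsingleton (V S) ≤1 (branch⊆S b) (branch⊆S b'))) b')
  where open MinorModel M

module Pullback {G H : Graph} {S A B : Sub G} (sp : Separation S A B) where
  open Separation sp
  open IsUnion union

  edge-A⊎B : ∀ {u w} → E S u w → E A u w ⊎ E B u w
  edge-A⊎B {u} {w} = Equivalence.to (edges u w)

  vertex-A⊎B : ∀ {g} → g ∈ V S → g ∈ V A ⊎ g ∈ V B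
  vertex-A⊎B {g} = Equivalence.to (vertices g)

  separator-unique : ∀ {y y'} → y ∈ V A → y ∈ V B → y' ∈ V A → y' ∈ V B → y ≡ y'
  separator-unique yA yB y'A y'B =
    ∣p∣≤1⇒Subsingleton (V A ∩ V B) small (x∈p∩q⁺ (yA , yB)) (x∈p∩q⁺ (y'A , y'B))

  _∩A : (Fin (n G) → Set) → Fin (n G) → Set
  (P ∩A) g = P g × g ∈ V A

  -- A walk enters A from outside only across an edge of B, hence through the separator vertex.
  walk-into-A : ∀ {P u v} → Walk S P u v → v ∈ V A →
                (u ∈ V A → Walk A (P ∩A) u v) ×
                (u ∉ V A → ∃[ y ] (y ∈ V A × y ∈ V B × P y × Walk A (P ∩A) y v))
  walk-into-A stop vA = (λ _ → stop) , (λ v∉A → ⊥-elim (v∉A vA))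
  walk-into-A {P} {u} {v} (step {w = w} e pw rest) vA with walk-into-A rest vA | edge-A⊎B e
  ... | from-w , _ | inj₁ eA with Eends A eA
  ...   | uA , wA = (λ _ → step eA (pw , wA) (from-w wA)) , (λ u∉A → ⊥-elim (u∉A uA))
  walk-into-A {P} {u} {v} (step {w = w} e pw rest) vA
    | from-w , via-separator | inj₂ eB with Eends B eB | w ∈? V A
  ...   | uB , wB | yes wA =
          (λ uA → subst (λ z → Walk A (P ∩A) z v) (separator-unique wA wB uA uB) (from-w wA))
        , (λ _ → w , wA , wB , pw , from-w wA)
  ...   | uB , _  | no w∉A =
          (λ uA → let (y , yA , yB , _ , walk) = via-separator w∉A in
                  subst (λ z → Walk A (P ∩A) z v) (separator-unique yA yB uA uB) walk)
        , (λ _ → via-separator w∉A)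

  walk-outside-A : ∀ {P : Fin (n G) → Set} {u v} → (∀ {g} → P g → g ∉ V A) →
                   Walk S P u v → u ∉ V A → Walk (B ∖V V A) (λ g → P g × g ∉ V A) u v
  walk-outside-A avoids stop             _   = stop
  walk-outside-A avoids (step e pw rest) u∉A with edge-A⊎B e
  ... | inj₁ eA = ⊥-elim (u∉A (proj₁ (Eends A eA)))
  ... | inj₂ eB = step (eB , u∉A , avoids pw) (pw , avoids pw) (walk-outside-A avoids rest (avoids pw))

  module _ {T : Sub H} (M : MinorModel T S) where
    open MinorModel M

    meets-A,B⇒meets-separator : ∀ {h} → h ∈ V T → Meets h (V A) → Meets h (V B) →
                                ∃[ y ] (y ∈ V A × y ∈ V B × branch h y)
    meets-A,B⇒meets-separator hT (g , b , gA) (g' , b' , g'B) with g ∈? V B | g' ∈? V A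
    ... | yes gB | _      = g , gA , gB , b
    ... | no _   | yes g'A = g' , g'A , g'B , b'
    ... | no _   | no g'∉A =
          let (y , yA , yB , by , _) = proj₂ (walk-into-A (connected hT b' b) gA) g'∉A
          in y , yA , yB , by

    meets-A,B-unique : ∀ {h h'} → h ∈ V T → h' ∈ V T →
                       Meets h (V A) → Meets h (V B) → Meets h' (V A) → Meets h' (V B) → h ≡ h'
    meets-A,B-unique hT h'T hA hB h'A h'B =
      let (y , yA , yB , by) = meets-A,B⇒meets-separator hT hA hB
          (y' , y'A , y'B , by') = meets-A,B⇒meets-separator h'T h'A h'B
      in disjoint by (subst (branch _) (sym (separator-unique yA yB y'A y'B)) by')

    model-in-A : (∀ {h} → h ∈ V T → Meets h (V A)) → MinorModel T A
    model-in-A meetsA = record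
      { branch    = λ h → branch h ∩A
      ; branch?   = λ h g → branch? h g ×-dec (g ∈? V A)
      ; branch⊆S  = proj₂
      ; disjoint  = λ b b' → disjoint (proj₁ b) (proj₁ b')
      ; nonempty  = meetsA
      ; connected = λ hT (b , gA) (b' , g'A) → proj₁ (walk-into-A (connected hT b b') g'A) gA
      ; edge      = edge-in-A }
      where
      edge-in-A : ∀ {h h'} → E T h h' → ∃[ g ] ∃[ g' ] ((branch h ∩A) g × (branch h' ∩A) g' × E A g g')
      edge-in-A {h} {h'} e with edge e
      ... | g , g' , b , b' , eS with edge-A⊎B eS
      ...   | inj₁ eA = g , g' , (b , proj₁ (Eends A eA)) , (b' , proj₂ (Eends A eA)) , eA
      ...   | inj₂ eB = ⊥-elim (irref H (E⊆ T (subst (E T h) (sym h≡h') e)))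
        where
        -- An edge of T realised in B makes both of its ends meet A and B.
        h≡h' : h ≡ h'
        h≡h' = let (hT , h'T) = Eends T e ; (gB , g'B) = Eends B eB in
               meets-A,B-unique hT h'T (meetsA hT) (g , b , gB) (meetsA h'T) (g' , b' , g'B)

    model-outside-A : (∀ {h g} → h ∈ V T → branch h g → g ∉ V A) → MinorModel T (B ∖V V A)
    model-outside-A avoidsA = record
      { branch    = λ h g → branch h g × g ∉ V A
      ; branch?   = λ h g → branch? h g ×-dec ¬? (g ∈? V A)
      ; branch⊆S  = λ (b , g∉A) → x∈p∧x∉q⇒x∈p─q (in-B b g∉A) g∉A
      ; disjoint  = λ b b' → disjoint (proj₁ b) (proj₁ b')
      ; nonempty  = λ hT → let (g , b) = nonempty hT in g , b , avoidsA hT b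
      ; connected = λ hT (b , g∉A) (b' , _) → walk-outside-A (avoidsA hT) (connected hT b b') g∉A
      ; edge      = edge-outside-A }
      where
      in-B : ∀ {h g} → branch h g → g ∉ V A → g ∈ V B
      in-B b g∉A with vertex-A⊎B (branch⊆S b)
      ... | inj₁ gA = ⊥-elim (g∉A gA)
      ... | inj₂ gB = gB
      edge-outside-A : ∀ {h h'} → E T h h' →
        ∃[ g ] ∃[ g' ] ((branch h g × g ∉ V A) × (branch h' g' × g' ∉ V A) × E (B ∖V V A) g g')
      edge-outside-A e with edge e
      ... | g , g' , b , b' , eS with edge-A⊎B eS
      ...   | inj₁ eA = ⊥-elim (g∉A (proj₁ (Eends A eA)))
        where g∉A = avoidsA (proj₁ (Eends T e)) b
      ...   | inj₂ eB = g , g' , (b , g∉A) , (b' , g'∉A) , (eB , g∉A , g'∉A)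
        where
        g∉A = avoidsA (proj₁ (Eends T e)) b
        g'∉A = avoidsA (proj₂ (Eends T e)) b'

  module _ {T : Sub H} (M : MinorModel T S) where
    open MinorModel M

    in-A′? : ∀ h → Dec (h ∈ V T × Meets h (V A))
    in-A′? h = (h ∈? V T) ×-dec meets? h (V A)

    in-B′? : ∀ h → Dec (h ∈ V T × Meets h (V B))
    in-B′? h = (h ∈? V T) ×-dec meets? h (V B)

    VA′ VB′ : Subset (n H)
    VA′ = select in-A′?
    VB′ = select in-B′?

    A′ : Sub H
    A′ = record
      { V     = VA′
      ; E     = λ h h' → E T h h' × h ∈ VA′ × h' ∈ VA′
      ; E⊆    = λ (e , _) → E⊆ T e
      ; Eends = proj₂
      ; Esym  = λ (e , hA′ , h'A′) → Esym T e , h'A′ , hA′ }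

    B′ : Sub H
    B′ = record
      { V     = VB′
      ; E     = λ h h' → E T h h' × h ∈ VB′ × h' ∈ VB′ × ¬ (h ∈ VA′ × h' ∈ VA′)
      ; E⊆    = λ (e , _) → E⊆ T e
      ; Eends = λ (_ , hB′ , h'B′ , _) → hB′ , h'B′
      ; Esym  = λ (e , hB′ , h'B′ , ¬A′) → Esym T e , h'B′ , hB′ , λ (h'A′ , hA′) → ¬A′ (hA′ , h'A′) }

    A′⊑T : A′ ⊑ T
    A′⊑T = record { V-mono = proj₁ ∘ ∈-select⁻ in-A′? ; E-mono = proj₁ }

    B′∖A′⊑T : (B′ ∖V VA′) ⊑ T
    B′∖A′⊑T = record
      { V-mono = proj₁ ∘ ∈-select⁻ in-B′? ∘ p─q⊆p VB′ VA′
      ; E-mono = proj₁ ∘ proj₁ }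

    A′∪B′≡T : IsUnion A′ B′ T
    A′∪B′≡T = record
      { vertices = λ h → mk⇔ vertex-A′⊎B′ [ proj₁ ∘ ∈-select⁻ in-A′? , proj₁ ∘ ∈-select⁻ in-B′? ]
      ; edges    = λ h h' → mk⇔ edge-A′⊎B′ [ proj₁ , proj₁ ] }
      where
      vertex-A′⊎B′ : ∀ {h} → h ∈ V T → h ∈ VA′ ⊎ h ∈ VB′
      vertex-A′⊎B′ hT with nonempty hT
      ... | g , b with vertex-A⊎B (branch⊆S b)
      ...   | inj₁ gA = inj₁ (∈-select⁺ in-A′? (hT , g , b , gA))
      ...   | inj₂ gB = inj₂ (∈-select⁺ in-B′? (hT , g , b , gB))
      edge-A′⊎B′ : ∀ {h h'} → E T h h' → E A′ h h' ⊎ E B′ h h'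
      edge-A′⊎B′ {h} {h'} e with (h ∈? VA′) ×-dec (h' ∈? VA′)
      ... | yes inA′ = inj₁ (e , inA′)
      ... | no ¬inA′ with edge e
      ...   | g , g' , b , b' , eS with edge-A⊎B eS
      ...     | inj₁ eA =
        let (hT , h'T) = Eends T e ; (gA , g'A) = Eends A eA in
        ⊥-elim (¬inA′ (∈-select⁺ in-A′? (hT , g , b , gA) , ∈-select⁺ in-A′? (h'T , g' , b' , g'A)))
      ...     | inj₂ eB =
        let (hT , h'T) = Eends T e ; (gB , g'B) = Eends B eB in
        inj₂ (e , ∈-select⁺ in-B′? (hT , g , b , gB) , ∈-select⁺ in-B′? (h'T , g' , b' , g'B) , ¬inA′)

    ∈A′∩B′⁻ : ∀ {h} → h ∈ VA′ ∩ VB′ → h ∈ V T × Meets h (V A) × Meets h (V B)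
    ∈A′∩B′⁻ h∈ = let (hA′ , hB′) = x∈p∩q⁻ VA′ VB′ h∈ in
      proj₁ (∈-select⁻ in-A′? hA′) , proj₂ (∈-select⁻ in-A′? hA′) , proj₂ (∈-select⁻ in-B′? hB′)

    A′∩B′-subsingleton : Subsingleton (VA′ ∩ VB′)
    A′∩B′-subsingleton h∈ h'∈ =
      let (hT , hA , hB) = ∈A′∩B′⁻ h∈ ; (h'T , h'A , h'B) = ∈A′∩B′⁻ h'∈
      in meets-A,B-unique M hT h'T hA hB h'A h'B

    ∣A′∩B′∣≤∣A∩B∣ : ∣ VA′ ∩ VB′ ∣ ≤ ∣ V A ∩ V B ∣
    ∣A′∩B′∣≤∣A∩B∣ = Subsingleton⇒∣p∣≤∣q∣ (VA′ ∩ VB′) (V A ∩ V B) A′∩B′-subsingleton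
      λ (_ , h∈) →
      let (hT , hA , hB) = ∈A′∩B′⁻ h∈ ; (y , yA , yB , _) = meets-A,B⇒meets-separator M hT hA hB
      in y , x∈p∩q⁺ (yA , yB)

    separation′ : Nonempty VA′ → Nonempty (VB′ ─ VA′) → Separation T A′ B′
    separation′ A′≢∅ B′∖A′≢∅ = record
      { union        = A′∪B′≡T
      ; edge-disj    = λ _ _ ((_ , inA′) , (_ , _ , _ , ¬inA′)) → ¬inA′ inA′
      ; small        = Subsingleton⇒∣p∣≤1 (VA′ ∩ VB′) A′∩B′-subsingleton
      ; A-nonempty   = A′≢∅
      ; B∖A-nonempty = B′∖A′≢∅ }

    Rtd≤-pullback : ∀ {k} j →
                    (∀ {T'} → MinorModel T' A → Rtd≤ T' k) →
                    (∀ {T'} → MinorModel T' (B ∖V V A) → Rtd≤ T' j) →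
                    j + ∣ V A ∩ V B ∣ ≤ k → 1 ≤ k → Rtd≤ T k
    Rtd≤-pullback j rtd-A rtd-B j+s≤k 1≤k with ∣ V T ∣ ≤? 1
    ... | yes ≤1 = Rtd≤-subsingleton ≤1 1≤k
    ... | no ≰1 with nonempty? VA′ | nonempty? (VB′ ─ VA′)
    ...   | no A′≡∅ | _ = Rtd≤-mono (rtd-B (model-outside-A M avoidsA)) (≤-trans (m≤m+n j _) j+s≤k)
      where
      avoidsA : ∀ {h g} → h ∈ V T → branch h g → g ∉ V A
      avoidsA hT b gA = A′≡∅ (_ , ∈-select⁺ in-A′? (hT , _ , b , gA))
    ...   | yes _ | no B′⊆A′ = rtd-A (model-in-A M meetsA)
      where
      meetsA : ∀ {h} → h ∈ V T → Meets h (V A)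
      meetsA {h} hT with h ∈? VA′ | Equivalence.to (IsUnion.vertices A′∪B′≡T h) hT
      ... | yes hA′ | _        = proj₂ (∈-select⁻ in-A′? hA′)
      ... | no h∉A′ | inj₁ hA′ = ⊥-elim (h∉A′ hA′)
      ... | no h∉A′ | inj₂ hB′ = ⊥-elim (B′⊆A′ (h , x∈p∧x∉q⇒x∈p─q hB′ h∉A′))
    ...   | yes A′≢∅ | yes B′∖A′≢∅ =
      sep (≰⇒> ≰1) A′ B′ (separation′ A′≢∅ B′∖A′≢∅)
          (rtd-A (model-in-A (MinorModel-restrict A′⊑T M) λ hA′ → proj₂ (∈-select⁻ in-A′? hA′)))
          j (rtd-B (model-outside-A (MinorModel-restrict B′∖A′⊑T M) avoidsA))
          (≤-trans (+-monoʳ-≤ j ∣A′∩B′∣≤∣A∩B∣) j+s≤k)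
      where
      avoidsA : ∀ {h g} → h ∈ VB′ ─ VA′ → branch h g → g ∉ V A
      avoidsA h∈ b gA = x∈p─q⇒x∉q VB′ VA′ h∈
        (∈-select⁺ in-A′? (proj₁ (∈-select⁻ in-B′? (p─q⊆p VB′ VA′ h∈)) , _ , b , gA))

Rtd≤-minor-mono : ∀ {G H} {S : Sub G} {T : Sub H} {k} → Rtd≤ S k → MinorModel T S → Rtd≤ T k
Rtd≤-minor-mono {S = S} (null empty) M =
  null (Empty⇒∣p∣≡0 (∣p∣≡0⇒Empty (V S) empty ∘ MinorModel-nonempty M))
Rtd≤-minor-mono (one single 1≤k) M =
  Rtd≤-subsingleton (MinorModel-subsingleton M (≤-reflexive single)) 1≤k
Rtd≤-minor-mono (sep _ A B sp rA j rB j+s≤k) M =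
  Pullback.Rtd≤-pullback sp M j (Rtd≤-minor-mono rA) (Rtd≤-minor-mono rB) j+s≤k
    (Rtd≤-positive rA (Separation.A-nonempty sp))

lemma24 : (G H : Graph) → Minor H G → (a b : ℕ) →
          rtd₂≡ H a → rtd₂≡ G b → a ≤ b
lemma24 G H minor a b (_ , a-least) (rtd-G≤b , _) =
  a-least b (Rtd≤-minor-mono rtd-G≤b (Minor⇒MinorModel minor))
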